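{- Let $G$ be any graph with stability number $\alpha(G)\leq 2$. Then $\chi(G)\leq \gamma_\ell(G)$, where $\gamma_\ell(G)=\max_{v\in V(G)}\left\lceil \tfrac12\bigl(d(v)+1+\omega(v)\bigr)\right\rceil$.
   Context: $d(v)$ is the degree of $v$ and $\omega(v)$ is the maximum size of a clique containing $v$. -}

module Defs where

open import Data.Nat using (ℕ; _≤_; _⊔_; ⌈_/2⌉; _+_)
open import Data.Fin using (Fin)
open import Data.Fin.Subset using (Subset; _∈_; ∣_∣)
open import Data.Bool using (Bool; true; false; T)
open import Data.List using (List; foldr; map; filter; length; allFin)
open import Data.Product using (Σ; ∃; _×_)
open import Relation.Binary.PropositionalEquality using (_≡_; _≢_)
open import Relation.Nullary using (¬_)
open import Relation.Nullary.Decidable using (T?)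

record Graph (n : ℕ) : Set where
  field
    adj   : Fin n → Fin n → Bool
    sym   : ∀ u v → adj u v ≡ adj v u
    irrefl : ∀ v → adj v v ≡ false

open Graph public

Adj : ∀ {n} → Graph n → Fin n → Fin n → Set
Adj G u v = T (adj G u v)

degree : ∀ {n} → Graph n → Fin n → ℕ
degree {n} G v = length (filter (λ u → T? (adj G v u)) (allFin n))

IsClique : ∀ {n} → Graph n → Subset n → Set
IsClique G S = ∀ u v → u ∈ S → v ∈ S → u ≢ v → Adj G u v

IsIndependent : ∀ {n} → Graph n → Subset n → Set
IsIndependent G S = ∀ u v → u ∈ S → v ∈ S → ¬ Adj G u v

StabilityAtMost : ∀ {n} → Graph n → ℕ → Set
StabilityAtMost G k = ∀ S → IsIndependent G S → ∣ S ∣ ≤ k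

IsLocalCliqueNumber : ∀ {n} → Graph n → Fin n → ℕ → Set
IsLocalCliqueNumber G v w =
  (Σ (Subset _) λ S → IsClique G S × v ∈ S × ∣ S ∣ ≡ w)
  × (∀ S → IsClique G S → v ∈ S → ∣ S ∣ ≤ w)

-- maximum of f over all vertices (0 for the empty graph)
maxOver : ∀ {n} → (Fin n → ℕ) → ℕ
maxOver {n} f = foldr _⊔_ 0 (map f (allFin n))

gammaL : ∀ {n} → Graph n → (Fin n → ℕ) → ℕ
gammaL G ω = maxOver (λ v → ⌈ (degree G v + 1 + ω v) /2⌉)

-- proper colouring with k colours;  χ(G) ≤ k  iff  G is k-colourable
Colorable : ∀ {n} → Graph n → ℕ → Set
Colorable {n} G k = Σ (Fin n → Fin k) λ c → ∀ u v → Adj G u v → c u ≢ c v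

-- Since α(G) ≤ 2, colour classes of G have at most two vertices, so proper colourings of G
-- correspond to matchings of the complement H of G: a matching M of H gives (n + def M)/2
-- colours, def M being the number of unmatched vertices. As n = d(v) + 1 + d_H(v), it suffices
-- to find a maximum matching M of H, a vertex v and an independent set I ∋ v of H (a clique of G)
-- with def M + d_H(v) ≤ |I| + 1. The Tutte–Berge theorem, proved via Gallai's lemma, provides S
-- and representatives R of distinct components of H − S with def M + |S| ≤ |R|. Let C be the
-- component of some r₀ ∈ R. If C has no edge, take v = r₀ and I = R, since every H-neighbour of r₀
-- lies in S. Otherwise take an edge ab of C with d_C(a) ≤ d_C(b), v = a and I = N_C(b) ∪ R ∖ {r₀},
-- which is independent because H is triangle-free. The argument is classical, which is harmless
-- because colourability with a given number of colours is decidable.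

module Submission where

open import Defs hiding (sym)

open import Data.Bool using (T; if_then_else_)
open import Data.Empty using (⊥)
open import Data.Fin using (Fin; zero; suc; fromℕ; inject₁; inject≤)
import Data.Fin.Properties as Fin
open import Data.Fin.Properties
  using (_≟_; any?; all?; fromℕ≢inject₁; inject₁-injective; inject≤-injective)
open import Data.Fin.Subset using (Subset)
import Data.Fin.Subset as Subset
open import Data.List using (length; filter)
import Data.List as List
import Data.List.Membership.Propositional as List using (_∈_)
open import Data.List.Membership.Propositional.Properties using (∈-map⁺; ∈-allFin)
open import Data.List.Relation.Unary.Any using (here; there)
open import Data.Maybe using (Maybe; just; nothing)
import Data.Maybe.Properties as Maybe
open import Data.Maybe.Properties using (just-injective)
open import Data.Nat using (ℕ; zero; suc; _+_; _*_; _≤_; _<_; _⊔_; z≤n; s≤s; ⌊_/2⌋; ⌈_/2⌉)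
open import Data.Nat.Induction using (<-wellFounded; <-rec)
open import Data.Nat.Properties
  using (≤-refl; ≤-trans; ≤-reflexive; ≤-antisym; ≤-total; ≤-pred; n≤1+n; n≤0⇒n≡0; <⇒≱; ≮⇒≥; ≤∧≢⇒<;
         +-mono-≤; +-monoʳ-≤; +-monoˡ-≤; +-suc; +-comm; +-identityʳ; *-suc; suc-injective; even≢odd;
         n≡⌊n+n/2⌋; ⌊n/2⌋-mono; m≤m⊔n; m≤n⊔m; +-commutativeSemigroup; module ≤-Reasoning)
open import Algebra.Properties.CommutativeSemigroup +-commutativeSemigroup
  using (interchange; x∙yz≈y∙xz)
open import Data.Nat.Tactic.RingSolver using (solve-∀)
open import Data.Product using (Σ; ∃; _×_; _,_; proj₁; proj₂)
open import Data.Sum using (_⊎_; inj₁; inj₂)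
import Data.Sum as Sum
open import Data.Unit using (⊤; tt)
open import Data.Vec using (Vec; []; _∷_)
import Data.Vec as Vec
open import Data.Vec.Properties using (lookup∘tabulate; []=⇒lookup; lookup⇒[]=)
open import Function using (_∘_; id; case_of_)
open import Function.Bundles using (mk⇔)
open import Induction.WellFounded using (module All)
import Relation.Binary.Construct.On as On
open import Relation.Binary.PropositionalEquality
  using (_≡_; _≢_; refl; sym; trans; cong; cong₂; subst; module ≡-Reasoning)
open import Relation.Nullary using (¬_; Dec; yes; no; does; contradiction)
open import Relation.Nullary.Decidable
  using (T?; ⌊_⌋; map′; ¬?; _×-dec_; _⊎-dec_; _→-dec_; does-⇔; dec-true; dec-false; isYes≗does;
         toWitness; fromWitness; decidable-stable; ¬¬-excluded-middle)
open import Relation.Nullary.Negation using (¬¬-map; negated-stable)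

private variable n : ℕ

-- Decidable sets of vertices and their cardinality

-- Unlike Data.Fin.Subset, membership in A ∩ B, A ∪ B and A ∖ B is definitionally ×, ⊎ and ×-¬.
record DecSet (n : ℕ) : Set₁ where
  field
    member  : Fin n → Set
    member? : ∀ x → Dec (member x)
open DecSet

infix 4 _∈_ _∉_ _⊆_ _≐_
infixr 7 _∩_
infixr 6 _∪_ _∖_

_∈_ : Fin n → DecSet n → Set
x ∈ A = member A x

_∉_ : Fin n → DecSet n → Set
x ∉ A = ¬ x ∈ A

_⊆_ : DecSet n → DecSet n → Set
A ⊆ B = ∀ {x} → x ∈ A → x ∈ B

_≐_ : DecSet n → DecSet n → Set
A ≐ B = A ⊆ B × B ⊆ A

∅ : DecSet n
∅ = record { member = λ _ → ⊥ ; member? = λ _ → no λ () }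

full : DecSet n
full = record { member = λ _ → ⊤ ; member? = λ _ → yes tt }

⁅_⁆ : Fin n → DecSet n
⁅ a ⁆ = record { member = _≡ a ; member? = _≟ a }

_∩_ : DecSet n → DecSet n → DecSet n
A ∩ B = record { member = λ x → x ∈ A × x ∈ B
                ; member? = λ x → member? A x ×-dec member? B x }

_∪_ : DecSet n → DecSet n → DecSet n
A ∪ B = record { member = λ x → x ∈ A ⊎ x ∈ B
                ; member? = λ x → member? A x ⊎-dec member? B x }

_∖_ : DecSet n → DecSet n → DecSet n
A ∖ B = record { member = λ x → x ∈ A × x ∉ B
                ; member? = λ x → member? A x ×-dec ¬? (member? B x) }

preimage : ∀ {m} → (Fin m → Fin n) → DecSet n → DecSet m
preimage f A = record { member = member A ∘ f ; member? = member? A ∘ f }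

indicator : ∀ {P : Set} → Dec P → ℕ
indicator p = if does p then 1 else 0

card : DecSet n → ℕ
card {zero}  A = 0
card {suc n} A = indicator (member? A zero) + card (preimage suc A)

module _ {P Q : Set} where

  indicator-mono : (P → Q) → (p : Dec P) (q : Dec Q) → indicator p ≤ indicator q
  indicator-mono f (no _)  q       = z≤n
  indicator-mono f (yes _) (yes _) = ≤-refl
  indicator-mono f (yes p) (no ¬q) = contradiction (f p) ¬q

  indicator-⊎ : (p : Dec P) (q : Dec Q) → indicator (p ⊎-dec q) ≤ indicator p + indicator q
  indicator-⊎ (yes _) q = s≤s z≤n
  indicator-⊎ (no _)  q = ≤-refl

  indicator-⊎-disjoint : (P → Q → ⊥) → (p : Dec P) (q : Dec Q) →
                         indicator (p ⊎-dec q) ≡ indicator p + indicator q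
  indicator-⊎-disjoint disj (yes p) (yes q) = contradiction q (disj p)
  indicator-⊎-disjoint disj (yes _) (no _)  = refl
  indicator-⊎-disjoint disj (no _)  q       = refl

card-mono : (A B : DecSet n) → A ⊆ B → card A ≤ card B
card-mono {zero}  A B A⊆B = z≤n
card-mono {suc n} A B A⊆B =
  +-mono-≤ (indicator-mono A⊆B (member? A zero) (member? B zero))
           (card-mono (preimage suc A) (preimage suc B) A⊆B)

card-≐ : (A B : DecSet n) → A ≐ B → card A ≡ card B
card-≐ A B (A⊆B , B⊆A) = ≤-antisym (card-mono A B A⊆B) (card-mono B A B⊆A)

card-∅ : card (∅ {n}) ≡ 0
card-∅ {zero}  = refl
card-∅ {suc n} = card-∅ {n}

card-empty : (A : DecSet n) → (∀ x → x ∉ A) → card A ≡ 0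
card-empty {n} A A-empty =
  n≤0⇒n≡0 (≤-trans (card-mono A ∅ (λ {x} → A-empty x)) (≤-reflexive (card-∅ {n})))

card-full : card (full {n}) ≡ n
card-full {zero}  = refl
card-full {suc n} = cong suc (card-full {n})

card-⁅⁆ : (x : Fin n) → card ⁅ x ⁆ ≡ 1
card-⁅⁆ {suc n} zero    = cong suc (card-empty {n} (preimage suc ⁅ zero ⁆) λ _ ())
card-⁅⁆ {suc n} (suc x) =
  trans (card-≐ (preimage suc ⁅ suc x ⁆) ⁅ x ⁆ (Fin.suc-injective , cong suc)) (card-⁅⁆ x)

card-∪ : (A B : DecSet n) → card (A ∪ B) ≤ card A + card B
card-∪ {zero}  A B = z≤n
card-∪ {suc n} A B = ≤-trans
  (+-mono-≤ (indicator-⊎ (member? A zero) (member? B zero)) (card-∪ (preimage suc A) (preimage suc B)))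
  (≤-reflexive (interchange (indicator (member? A zero)) (indicator (member? B zero)) _ _))

card-∪-disjoint : (A B : DecSet n) → (∀ {x} → x ∈ A → x ∈ B → ⊥) →
                  card (A ∪ B) ≡ card A + card B
card-∪-disjoint {zero}  A B disj = refl
card-∪-disjoint {suc n} A B disj = trans
  (cong₂ _+_ (indicator-⊎-disjoint disj (member? A zero) (member? B zero))
             (card-∪-disjoint (preimage suc A) (preimage suc B) disj))
  (interchange (indicator (member? A zero)) (indicator (member? B zero)) _ _)

card-remove : (A : DecSet n) (x : Fin n) → x ∈ A → card A ≡ suc (card (A ∖ ⁅ x ⁆))
card-remove A x x∈A = begin
  card A                         ≡⟨ card-≐ A (⁅ x ⁆ ∪ A ∖ ⁅ x ⁆) (split , merge) ⟩
  card (⁅ x ⁆ ∪ A ∖ ⁅ x ⁆)       ≡⟨ card-∪-disjoint ⁅ x ⁆ (A ∖ ⁅ x ⁆) (λ t≡x (_ , t≢x) → t≢x t≡x) ⟩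
  card ⁅ x ⁆ + card (A ∖ ⁅ x ⁆)  ≡⟨ cong (_+ card (A ∖ ⁅ x ⁆)) (card-⁅⁆ x) ⟩
  suc (card (A ∖ ⁅ x ⁆))         ∎
  where
  open ≡-Reasoning
  split : A ⊆ ⁅ x ⁆ ∪ A ∖ ⁅ x ⁆
  split {t} t∈A with t ≟ x
  ... | yes t≡x = inj₁ t≡x
  ... | no  t≢x = inj₂ (t∈A , t≢x)
  merge : ⁅ x ⁆ ∪ A ∖ ⁅ x ⁆ ⊆ A
  merge (inj₁ refl)      = x∈A
  merge (inj₂ (t∈A , _)) = t∈A

card-remove-≐ : (A B : DecSet n) (x : Fin n) → x ∈ A → A ∖ ⁅ x ⁆ ≐ B →
                card A ≡ suc (card B)
card-remove-≐ A B x x∈A A∖x≐B =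
  trans (card-remove A x x∈A) (cong suc (card-≐ (A ∖ ⁅ x ⁆) B A∖x≐B))

-- Classical reasoning

-- Not ¬¬-Monad from the library: the two types may live at different levels.
infixl 1 _>>=_
_>>=_ : ∀ {a b} {A : Set a} {B : Set b} → ¬ ¬ A → (A → ¬ ¬ B) → ¬ ¬ B
¬¬a >>= f = negated-stable (¬¬-map f ¬¬a)

pure : ∀ {a} {A : Set a} → A → ¬ ¬ A
pure a ¬a = ¬a a

¬¬-decidable : ∀ {ℓ} (P : Fin n → Set ℓ) → ¬ ¬ (∀ x → Dec (P x))
¬¬-decidable {zero}  P = pure λ ()
¬¬-decidable {suc n} P =
  ¬¬-excluded-middle >>= λ P₀? → ¬¬-decidable (P ∘ suc) >>= λ P₊? →
  pure λ { zero → P₀? ; (suc x) → P₊? x }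

measure-rec : ∀ {a ℓ} {A : Set a} (μ : A → ℕ) (P : A → Set ℓ) →
              (∀ x → (∀ {y} → μ y < μ x → P y) → P x) → ∀ x → P x
measure-rec {ℓ = ℓ} μ = All.wfRec (On.wellFounded μ <-wellFounded) ℓ

Adj-sym : ∀ (G : Graph n) {u v} → Adj G u v → Adj G v u
Adj-sym G {u} {v} = subst T (Graph.sym G u v)

Adj⇒≢ : ∀ (G : Graph n) {u v} → Adj G u v → u ≢ v
Adj⇒≢ G {u} u~u refl = subst T (Graph.irrefl G u) u~u

neighbours : Graph n → Fin n → DecSet n
neighbours G v = record { member = Adj G v ; member? = T? ∘ adj G v }

-- Matchings

module Matchings {n : ℕ} (H : Graph n) where

  private
    variable
      W : DecSet n
      L : ℕ
      s t x y z : Fin n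

    _≟ₘ_ : (a b : Maybe (Fin n)) → Dec (a ≡ b)
    _≟ₘ_ = Maybe.≡-dec _≟_

  data Walk (A : DecSet n) : Fin n → Fin n → ℕ → Set where
    [_]  : ∀ {x} → x ∈ A → Walk A x x 0
    step : ∀ {x y z L} → x ∈ A → Adj H x y → Walk A y z L → Walk A x z (suc L)

  walk-head : ∀ {A} → Walk A x y L → x ∈ A
  walk-head [ x∈A ]          = x∈A
  walk-head (step x∈A _ _) = x∈A

  walk-snoc : ∀ {A} → Walk A x y L → Adj H y z → z ∈ A → Walk A x z (suc L)
  walk-snoc [ x∈A ]             y~z z∈A = step x∈A y~z [ z∈A ]
  walk-snoc (step x∈A x~t rest) y~z z∈A = step x∈A x~t (walk-snoc rest y~z z∈A)

  walk-mono : ∀ {A B} → A ⊆ B → Walk A x y L → Walk B x y L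
  walk-mono A⊆B [ x∈A ]             = [ A⊆B x∈A ]
  walk-mono A⊆B (step x∈A x~t rest) = step (A⊆B x∈A) x~t (walk-mono A⊆B rest)

  record Matching (W : DecSet n) : Set where
    field
      partner     : Fin n → Maybe (Fin n)
      partner-sym : ∀ {x y} → partner x ≡ just y → partner y ≡ just x
      partner-adj : ∀ {x y} → partner x ≡ just y → Adj H x y
      partner-∈   : ∀ {x y} → partner x ≡ just y → x ∈ W
  open Matching public

  freeOf : (Fin n → Maybe (Fin n)) → DecSet n
  freeOf p = record { member = λ x → p x ≡ nothing ; member? = λ x → p x ≟ₘ nothing }

  unmatched : Matching W → DecSet n
  unmatched {W} M = W ∩ freeOf (partner M)

  def : Matching W → ℕ
  def M = card (unmatched M)

  IsMaximum : Matching W → Set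
  IsMaximum {W} M = (N : Matching W) → def M ≤ def N

  partner-≢ : (M : Matching W) → partner M x ≡ just y → x ≢ y
  partner-≢ M = Adj⇒≢ H ∘ partner-adj M

  free-not-mate : (M : Matching W) {x y : Fin n} → partner M x ≡ nothing → partner M y ≢ just x
  free-not-mate M x-free y↦x with () ← trans (sym x-free) (partner-sym M y↦x)

  empty-matching : Matching W
  empty-matching = record
    { partner = λ _ → nothing ; partner-sym = λ () ; partner-adj = λ () ; partner-∈ = λ () }

  module _ (p : Fin n → Maybe (Fin n)) (x : Fin n) where

    without : Fin n → Maybe (Fin n)
    without t with t ≟ x | p t ≟ₘ just x
    ... | yes _ | _     = nothing
    ... | no _  | yes _ = nothing
    ... | no _  | no _  = p t

    without-just : without t ≡ just s → p t ≡ just s × t ≢ x × p t ≢ just x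
    without-just {t} t↦s with t ≟ x | p t ≟ₘ just x
    ... | no t≢x | no t↛x = t↦s , t≢x , t↛x

    without-other : t ≢ x → p t ≢ just x → without t ≡ p t
    without-other {t} t≢x t↛x with t ≟ x | p t ≟ₘ just x
    ... | yes t≡x | _       = contradiction t≡x t≢x
    ... | no _    | yes t↦x = contradiction t↦x t↛x
    ... | no _    | no _    = refl

    without-mate : p t ≡ just x → without t ≡ nothing
    without-mate {t} t↦x with t ≟ x | p t ≟ₘ just x
    ... | yes _ | _      = refl
    ... | no _  | yes _  = refl
    ... | no _  | no t↛x = contradiction t↦x t↛x

    without-free : p t ≡ nothing → without t ≡ nothing
    without-free {t} t-free with t ≟ x | p t ≟ₘ just x
    ... | yes _ | _     = refl
    ... | no _  | yes _ = refl
    ... | no _  | no _  = t-free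

  remove : Matching W → (x : Fin n) → Matching (W ∖ ⁅ x ⁆)
  remove M x = record
    { partner     = without (partner M) x
    ; partner-sym = mate
    ; partner-adj = partner-adj M ∘ proj₁ ∘ without-just (partner M) x
    ; partner-∈   = λ t↦s → let (t↦s , t≢x , _) = without-just (partner M) x t↦s
                            in partner-∈ M t↦s , t≢x
    }
    where
    mate : ∀ {t s} → without (partner M) x t ≡ just s → without (partner M) x s ≡ just t
    mate {t} {s} t↦s with without-just (partner M) x t↦s
    ... | t↦s , t≢x , t↛x = trans (without-other (partner M) x s≢x s↛x) (partner-sym M t↦s)
      where
      s≢x : s ≢ x
      s≢x refl = t↛x t↦s
      s↛x : partner M s ≢ just x
      s↛x s↦x = t≢x (just-injective (trans (sym (partner-sym M t↦s)) s↦x))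

  partner-outside : (M : Matching W) → x ∉ W → partner M x ≡ nothing
  partner-outside {x = x} M x∉W with partner M x in x↦
  ... | nothing = refl
  ... | just _  = contradiction (partner-∈ M x↦) x∉W

  def-remove-free : (M : Matching W) → x ∈ unmatched M → def M ≡ suc (def (remove M x))
  def-remove-free {W} {x} M x∈U@(_ , x-free) =
    card-remove-≐ (unmatched M) (unmatched (remove M x)) x x∈U (to , from)
    where
    to : unmatched M ∖ ⁅ x ⁆ ⊆ unmatched (remove M x)
    to ((t∈W , t-free) , t≢x) = (t∈W , t≢x) , without-free (partner M) x t-free
    from : unmatched (remove M x) ⊆ unmatched M ∖ ⁅ x ⁆
    from ((t∈W , t≢x) , t-free) =
      (t∈W , trans (sym (without-other (partner M) x t≢x (free-not-mate M x-free))) t-free) , t≢x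

  remove-frees-mate : (M : Matching W) → partner M x ≡ just y → y ∈ unmatched (remove M x)
  remove-frees-mate {x = x} {y = y} M x↦y =
    (partner-∈ M y↦x , partner-≢ M y↦x) , without-mate (partner M) x y↦x
    where
    y↦x : partner M y ≡ just x
    y↦x = partner-sym M x↦y

  def-remove-matched : (M : Matching W) → partner M x ≡ just y → def (remove M x) ≡ suc (def M)
  def-remove-matched {W} {x} {y} M x↦y =
    card-remove-≐ (unmatched (remove M x)) (unmatched M) y (remove-frees-mate M x↦y) (to , from)
    where
    y↦x : partner M y ≡ just x
    y↦x = partner-sym M x↦y
    to : unmatched (remove M x) ∖ ⁅ y ⁆ ⊆ unmatched M
    to {t} (((t∈W , t≢x) , t-free) , t≢y) =
      t∈W , trans (sym (without-other (partner M) x t≢x t↛x)) t-free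
      where
      t↛x : partner M t ≢ just x
      t↛x t↦x = t≢y (just-injective (trans (sym (partner-sym M t↦x)) x↦y))
    from : unmatched M ⊆ unmatched (remove M x) ∖ ⁅ y ⁆
    from (t∈W , t-free) =
      ((t∈W , λ { refl → free-not-mate M t-free y↦x }) , without-free (partner M) x t-free) ,
      λ { refl → free-not-mate M t-free x↦y }

  restore : ∀ W x → Matching (W ∖ ⁅ x ⁆) → Matching W
  restore W x N = record
    { partner = partner N ; partner-sym = partner-sym N ; partner-adj = partner-adj N
    ; partner-∈ = proj₁ ∘ partner-∈ N }

  restore-free : ∀ W x (N : Matching (W ∖ ⁅ x ⁆)) → partner (restore W x N) x ≡ nothing
  restore-free W x N = partner-outside N λ (_ , x≢x) → x≢x refl

  def-restore : ∀ {W x} → x ∈ W → (N : Matching (W ∖ ⁅ x ⁆)) →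
                def (restore W x N) ≡ suc (def N)
  def-restore {W} {x} x∈W N =
    card-remove-≐ (unmatched (restore W x N)) (unmatched N) x (x∈W , restore-free W x N) (to , from)
    where
    to : unmatched (restore W x N) ∖ ⁅ x ⁆ ⊆ unmatched N
    to ((t∈W , t-free) , t≢x) = (t∈W , t≢x) , t-free
    from : unmatched N ⊆ unmatched (restore W x N) ∖ ⁅ x ⁆
    from ((t∈W , t≢x) , t-free) = (t∈W , t-free) , t≢x

  module _ (p : Fin n → Maybe (Fin n)) (x y : Fin n) where

    linked : Fin n → Maybe (Fin n)
    linked t with t ≟ x | t ≟ y
    ... | yes _ | _     = just y
    ... | no _  | yes _ = just x
    ... | no _  | no _  = p t

    linked-left : linked x ≡ just y
    linked-left with x ≟ x
    ... | yes _  = refl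
    ... | no x≢x = contradiction refl x≢x

    linked-right : x ≢ y → linked y ≡ just x
    linked-right x≢y with y ≟ x | y ≟ y
    ... | yes y≡x | _      = contradiction (sym y≡x) x≢y
    ... | no _    | yes _  = refl
    ... | no _    | no y≢y = contradiction refl y≢y

    linked-other : t ≢ x → t ≢ y → linked t ≡ p t
    linked-other {t} t≢x t≢y with t ≟ x | t ≟ y
    ... | yes t≡x | _       = contradiction t≡x t≢x
    ... | no _    | yes t≡y = contradiction t≡y t≢y
    ... | no _    | no _    = refl

  link : (M : Matching W) → x ∈ unmatched M → y ∈ unmatched M → Adj H x y → Matching W
  link {W} {x} {y} M (x∈W , x-free) (y∈W , y-free) x~y = record
    { partner = linked (partner M) x y ; partner-sym = mate ; partner-adj = edge ; partner-∈ = inW }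
    where
    x≢y : x ≢ y
    x≢y = Adj⇒≢ H x~y
    mate : ∀ {t s} → linked (partner M) x y t ≡ just s → linked (partner M) x y s ≡ just t
    mate {t} t↦s with t ≟ x | t ≟ y
    mate refl | yes refl | _      = linked-right (partner M) x y x≢y
    mate refl | no _     | yes refl = linked-left (partner M) x y
    mate {s = s} t↦s | no t≢x | no t≢y =
      trans (linked-other (partner M) x y s≢x s≢y) (partner-sym M t↦s)
      where
      s≢x : s ≢ x
      s≢x refl = free-not-mate M x-free t↦s
      s≢y : s ≢ y
      s≢y refl = free-not-mate M y-free t↦s
    edge : ∀ {t s} → linked (partner M) x y t ≡ just s → Adj H t s
    edge {t} t↦s with t ≟ x | t ≟ y
    edge refl | yes refl | _      = x~y
    edge refl | no _     | yes refl = Adj-sym H x~y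
    edge t↦s | no _     | no _    = partner-adj M t↦s
    inW : ∀ {t s} → linked (partner M) x y t ≡ just s → t ∈ W
    inW {t} t↦s with t ≟ x | t ≟ y
    ... | yes refl | _      = x∈W
    ... | no _     | yes refl = y∈W
    ... | no _     | no _   = partner-∈ M t↦s

  def-link : (M : Matching W) (x∈U : x ∈ unmatched M) (y∈U : y ∈ unmatched M)
             (x~y : Adj H x y) → def M ≡ suc (suc (def (link M x∈U y∈U x~y)))
  def-link {W} {x} {y} M x∈U y∈U x~y = begin
    card (unmatched M)               ≡⟨ card-remove (unmatched M) x x∈U ⟩
    suc (card (unmatched M ∖ ⁅ x ⁆)) ≡⟨ cong suc (card-remove-≐ _ (unmatched M′) y y∈U′ (to , from)) ⟩
    suc (suc (card (unmatched M′)))  ∎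
    where
    open ≡-Reasoning
    M′ : Matching W
    M′ = link M x∈U y∈U x~y
    y∈U′ : y ∈ unmatched M ∖ ⁅ x ⁆
    y∈U′ = y∈U , Adj⇒≢ H x~y ∘ sym
    to : (unmatched M ∖ ⁅ x ⁆) ∖ ⁅ y ⁆ ⊆ unmatched M′
    to (((t∈W , t-free) , t≢x) , t≢y) = t∈W , trans (linked-other (partner M) x y t≢x t≢y) t-free
    from : unmatched M′ ⊆ (unmatched M ∖ ⁅ x ⁆) ∖ ⁅ y ⁆
    from {t} (t∈W , t-free) =
      ((t∈W , trans (sym (linked-other (partner M) x y t≢x t≢y)) t-free) , t≢x) , t≢y
      where
      t≢x : t ≢ x
      t≢x refl with () ← trans (sym t-free) (linked-left (partner M) x y)
      t≢y : t ≢ y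
      t≢y refl with () ← trans (sym t-free) (linked-right (partner M) x y (Adj⇒≢ H x~y))

  no-augmenting-edge : (M : Matching W) → IsMaximum M →
                       x ∈ unmatched M → y ∈ unmatched M → ¬ Adj H x y
  no-augmenting-edge M M-max x∈U y∈U x~y =
    <⇒≱ (≤-trans (n≤1+n _) (≤-reflexive (sym (def-link M x∈U y∈U x~y))))
        (M-max (link M x∈U y∈U x~y))

  maximum-exists : (W : DecSet n) → ¬ ¬ Σ (Matching W) IsMaximum
  maximum-exists W no-maximum = measure-rec (def {W}) (λ _ → ⊥) improve empty-matching
    where
    improve : (M : Matching W) → (∀ {N : Matching W} → def N < def M → ⊥) → ⊥
    improve M no-better = no-maximum (M , λ N → ≮⇒≥ (no-better {N}))

  record PairClasses (M : Matching W) : Set where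
    field
      classes         : ℕ
      classes-twice   : 2 * classes ≡ card W + def M
      class           : ∀ x → x ∈ W → Fin classes
      class-injective : ∀ {x y} (x∈W : x ∈ W) (y∈W : y ∈ W) →
                        class x x∈W ≡ class y y∈W → x ≡ y ⊎ partner M x ≡ just y
  open PairClasses

  private
    inherit-class : ∀ {M : Matching W} {t s} → t ≡ s ⊎ without (partner M) x t ≡ just s →
                    t ≡ s ⊎ partner M t ≡ just s
    inherit-class {x = x} {M} = Sum.map₂ (proj₁ ∘ without-just (partner M) x)

  classes-of-empty : (∀ x → x ∉ W) → (M : Matching W) → PairClasses M
  classes-of-empty {W} W-empty M = record
    { classes = 0
    ; classes-twice = sym (cong₂ _+_ (card-empty W W-empty)
                                     (card-empty (unmatched M) (λ x → W-empty x ∘ proj₁)))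
    ; class = λ x x∈W → contradiction x∈W (W-empty x)
    ; class-injective = λ x∈W → contradiction x∈W (W-empty _)
    }

  classes-add-free : (M : Matching W) → x ∈ unmatched M →
                     PairClasses (remove M x) → PairClasses M
  classes-add-free {W} {x} M x∈U@(x∈W , _) C = record
    { classes = suc k ; classes-twice = twice ; class = cls ; class-injective = cls-injective }
    where
    k : ℕ
    k = classes C
    twice : 2 * suc k ≡ card W + def M
    twice = begin
      2 * suc k                                       ≡⟨ *-suc 2 k ⟩
      suc (suc (2 * k))                               ≡⟨ cong (λ m → suc (suc m)) (classes-twice C) ⟩
      suc (suc (card (W ∖ ⁅ x ⁆) + def (remove M x))) ≡⟨ cong suc (+-suc _ _) ⟨
      suc (card (W ∖ ⁅ x ⁆)) + suc (def (remove M x)) ≡⟨ cong₂ _+_ (card-remove W x x∈W) (def-remove-free M x∈U) ⟨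
      card W + def M                                  ∎
      where open ≡-Reasoning
    cls : ∀ t → t ∈ W → Fin (suc k)
    cls t t∈W with t ≟ x
    ... | yes _   = fromℕ k
    ... | no  t≢x = inject₁ (class C t (t∈W , t≢x))
    cls-injective : ∀ {t s} (t∈W : t ∈ W) (s∈W : s ∈ W) →
                    cls t t∈W ≡ cls s s∈W → t ≡ s ⊎ partner M t ≡ just s
    cls-injective {t} {s} t∈W s∈W same with t ≟ x | s ≟ x
    ... | yes refl | yes refl = inj₁ refl
    ... | yes _    | no _     = contradiction same fromℕ≢inject₁
    ... | no _     | yes _    = contradiction (sym same) fromℕ≢inject₁
    ... | no t≢x   | no s≢x   =
      inherit-class {M = M} (class-injective C (t∈W , t≢x) (s∈W , s≢x) (inject₁-injective same))

  classes-add-matched : (M : Matching W) → partner M x ≡ just y →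
                        PairClasses (remove M x) → PairClasses M
  classes-add-matched {W} {x} {y} M x↦y C = record
    { classes = classes C ; classes-twice = twice ; class = cls ; class-injective = cls-injective }
    where
    y∈U : y ∈ unmatched (remove M x)
    y∈U = remove-frees-mate M x↦y
    twice : 2 * classes C ≡ card W + def M
    twice = begin
      2 * classes C                       ≡⟨ classes-twice C ⟩
      card (W ∖ ⁅ x ⁆) + def (remove M x) ≡⟨ cong (card (W ∖ ⁅ x ⁆) +_) (def-remove-matched M x↦y) ⟩
      card (W ∖ ⁅ x ⁆) + suc (def M)      ≡⟨ +-suc _ _ ⟩
      suc (card (W ∖ ⁅ x ⁆)) + def M      ≡⟨ cong (_+ def M) (card-remove W x (partner-∈ M x↦y)) ⟨
      card W + def M                      ∎
      where open ≡-Reasoning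
    cls : ∀ t → t ∈ W → Fin (classes C)
    cls t t∈W with t ≟ x
    ... | yes _   = class C y (proj₁ y∈U)
    ... | no  t≢x = class C t (t∈W , t≢x)
    only-y : ∀ {t} (t∈W₁ : t ∈ W ∖ ⁅ x ⁆) → class C t t∈W₁ ≡ class C y (proj₁ y∈U) → t ≡ y
    only-y {t} t∈W₁ same with class-injective C t∈W₁ (proj₁ y∈U) same
    ... | inj₁ t≡y = t≡y
    ... | inj₂ t↦y = contradiction t↦y (free-not-mate (remove M x) {y = t} (proj₂ y∈U))
    cls-injective : ∀ {t s} (t∈W : t ∈ W) (s∈W : s ∈ W) →
                    cls t t∈W ≡ cls s s∈W → t ≡ s ⊎ partner M t ≡ just s
    cls-injective {t} {s} t∈W s∈W same with t ≟ x | s ≟ x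
    ... | yes refl | yes refl = inj₁ refl
    ... | yes refl | no s≢x   with refl ← only-y (s∈W , s≢x) (sym same) = inj₂ x↦y
    ... | no t≢x   | yes refl with refl ← only-y (t∈W , t≢x) same = inj₂ (partner-sym M x↦y)
    ... | no t≢x   | no s≢x   = inherit-class {M = M} (class-injective C (t∈W , t≢x) (s∈W , s≢x) same)

  pair-classes : (M : Matching W) → PairClasses M
  pair-classes {W} = measure-rec card (λ W → (M : Matching W) → PairClasses M) build W
    where
    build : ∀ W → (∀ {W′} → card W′ < card W → (M : Matching W′) → PairClasses M) →
            (M : Matching W) → PairClasses M
    build W rec M with any? (member? W)
    ... | no ∄x         = classes-of-empty (λ x x∈W → ∄x (x , x∈W)) M
    ... | yes (x , x∈W) = add (rec (≤-reflexive (sym (card-remove W x x∈W))) (remove M x))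
      where
      add : PairClasses (remove M x) → PairClasses M
      add with partner M x in x↦
      ... | nothing = classes-add-free M (x∈W , x↦)
      ... | just _  = classes-add-matched M x↦

  def-parity : ∀ {W x} → x ∈ W → (M : Matching W) (N : Matching (W ∖ ⁅ x ⁆)) →
               def M ≢ def N
  def-parity {W} {x} x∈W M N same = even≢odd (classes CM) (classes CN) (begin
    2 * classes CM                    ≡⟨ classes-twice CM ⟩
    card W + def M                    ≡⟨ cong₂ _+_ (card-remove W x x∈W) same ⟩
    suc (card (W ∖ ⁅ x ⁆) + def N)    ≡⟨ cong suc (sym (classes-twice CN)) ⟩
    suc (2 * classes CN)              ∎)
    where
    open ≡-Reasoning
    CM : PairClasses M
    CM = pair-classes M
    CN : PairClasses N
    CN = pair-classes N

  disagreement : Matching W → Matching W → DecSet n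
  disagreement M N = record
    { member  = λ x → partner M x ≢ partner N x
    ; member? = λ x → ¬? (partner M x ≟ₘ partner N x) }

  module Exchange (N : Matching W) {z z′ y} (z∈U : z ∈ unmatched N) (z~z′ : Adj H z z′)
                  (z′↦y : partner N z′ ≡ just y) where

    private
      N₀ : Matching W
      N₀ = restore W z′ (remove N z′)
      z∈U₀ : z ∈ unmatched N₀
      z∈U₀ = proj₁ z∈U , without-free (partner N) z′ (proj₂ z∈U)
      z′∈U₀ : z′ ∈ unmatched N₀
      z′∈U₀ = partner-∈ N z′↦y , restore-free W z′ (remove N z′)

    exchanged : Matching W
    exchanged = link N₀ z∈U₀ z′∈U₀ z~z′

    def-exchanged : def exchanged ≡ def N
    def-exchanged = suc-injective (suc-injective (begin
      suc (suc (def exchanged))     ≡⟨ sym (def-link N₀ z∈U₀ z′∈U₀ z~z′) ⟩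
      def N₀                        ≡⟨ def-restore {W} (partner-∈ N z′↦y) (remove N z′) ⟩
      suc (def (remove N z′))       ≡⟨ cong suc (def-remove-matched N z′↦y) ⟩
      suc (suc (def N))             ∎))
      where open ≡-Reasoning

    exchanged-maximum : IsMaximum N → IsMaximum exchanged
    exchanged-maximum N-max P = subst (_≤ def P) (sym def-exchanged) (N-max P)

    exchanged-keeps-free : ∀ {t} → t ∈ unmatched N → t ≢ z → t ∈ unmatched exchanged
    exchanged-keeps-free {t} (t∈W , t-free) t≢z =
      t∈W , trans (linked-other (partner N₀) z z′ t≢z t≢z′) (without-free (partner N) z′ t-free)
      where
      t≢z′ : t ≢ z′
      t≢z′ refl = free-not-mate N t-free (partner-sym N z′↦y)

    exchanged-closer : (M : Matching W) → partner M z ≡ just z′ →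
                       card (disagreement M exchanged) < card (disagreement M N)
    exchanged-closer M z↦z′ = begin-strict
      card (disagreement M exchanged) ≤⟨ card-mono _ _ (λ {a} → shrinks {a}) ⟩
      card (disagreement M N ∖ ⁅ z ⁆)  <⟨ ≤-reflexive (sym (card-remove _ z z-disagrees)) ⟩
      card (disagreement M N)         ∎
      where
      open ≤-Reasoning
      z-disagrees : z ∈ disagreement M N
      z-disagrees same with () ← trans (sym z↦z′) (trans same (proj₂ z∈U))
      agrees : ∀ a → partner M a ≡ partner N a → a ≢ z → partner M a ≡ partner exchanged a
      agrees a same a≢z = by-cases (a ≟ z′)
        where
        a↛z′ : partner N a ≢ just z′
        a↛z′ a↦z′ = a≢z (just-injective
          (trans (sym (partner-sym M (trans same a↦z′))) (partner-sym M z↦z′)))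
        by-cases : Dec (a ≡ z′) → partner M a ≡ partner exchanged a
        by-cases (yes refl) =
          trans (partner-sym M z↦z′) (sym (linked-right (partner N₀) z z′ (Adj⇒≢ H z~z′)))
        by-cases (no a≢z′)  = trans same (sym (trans (linked-other (partner N₀) z z′ a≢z a≢z′)
                                                     (without-other (partner N) z′ a≢z′ a↛z′)))
      shrinks : disagreement M exchanged ⊆ disagreement M N ∖ ⁅ z ⁆
      shrinks {a} differ = (λ same → differ (agrees a same a≢z)) , a≢z
        where
        a≢z : a ≢ z
        a≢z refl = differ (trans z↦z′ (sym (linked-left (partner N₀) z z′)))

  fewer-unmatched : (M N : Matching W) {t u v : Fin n} → t ∈ unmatched N →
                    u ∈ unmatched M → v ∈ unmatched M → u ≢ v →
                    u ∉ unmatched N → v ∉ unmatched N →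
                    unmatched N ∖ ⁅ t ⁆ ⊆ unmatched M → def N < def M
  fewer-unmatched M N {t} {u} {v} t∈UN u∈UM v∈UM u≢v u∉UN v∉UN UN-t⊆UM = begin-strict
    def N                            ≡⟨ card-remove (unmatched N) t t∈UN ⟩
    suc (card (unmatched N ∖ ⁅ t ⁆)) ≤⟨ s≤s (card-mono (unmatched N ∖ ⁅ t ⁆) UM-u-v into) ⟩
    suc (card UM-u-v)                <⟨ ≤-refl ⟩
    suc (suc (card UM-u-v))          ≡⟨ cong suc (card-remove (unmatched M ∖ ⁅ u ⁆) v (v∈UM , u≢v ∘ sym)) ⟨
    suc (card (unmatched M ∖ ⁅ u ⁆)) ≡⟨ card-remove (unmatched M) u u∈UM ⟨
    def M                            ∎
    where
    open ≤-Reasoning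
    UM-u-v : DecSet n
    UM-u-v = (unmatched M ∖ ⁅ u ⁆) ∖ ⁅ v ⁆
    into : unmatched N ∖ ⁅ t ⁆ ⊆ UM-u-v
    into x∈ = (UN-t⊆UM x∈ , λ { refl → u∉UN (proj₁ x∈) }) , λ { refl → v∉UN (proj₁ x∈) }

  -- Gallai's lemma and Tutte–Berge barriers

  Avoidable : DecSet n → Fin n → Set
  Avoidable W x = Σ (Matching W) λ N → IsMaximum N × x ∈ unmatched N

  module Gallai {W : DecSet n} (avoidable : ∀ {x} → x ∈ W → ¬ ¬ Avoidable W x) where

    Separated : ℕ → Set
    Separated L = (M : Matching W) → IsMaximum M →
                  ∀ {u v} → u ∈ unmatched M → v ∈ unmatched M → u ≢ v → ¬ Walk W u v L

    -- A walk u t … v between distinct vertices unmatched by M, with t matched: among the maximum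
    -- matchings avoiding t, one closest to M avoids u (then ut augments it) or v (then t … v is a
    -- shorter counterexample), for otherwise the exchange at a vertex z that it avoids but M covers
    -- gives a maximum matching still avoiding t and closer to M.
    module _ {L} (separated-L : Separated L) (M : Matching W) (M-max : IsMaximum M)
             {u v t} (u∈U : u ∈ unmatched M) (v∈U : v ∈ unmatched M) (u≢v : u ≢ v)
             (u~t : Adj H u t) (t∉U : t ∉ unmatched M) (rest : Walk W t v L) where

      private
        Refuted : Matching W → Set
        Refuted N = IsMaximum N → t ∈ unmatched N → ⊥

      avoiding-t-refuted : (N : Matching W) → Refuted N
      avoiding-t-refuted = measure-rec (card ∘ disagreement M) Refuted refute
        where
        refute : ∀ N → (∀ {N′} → card (disagreement M N′) < card (disagreement M N) → Refuted N′) →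
                 Refuted N
        refute N closer-refuted N-max t∈UN with member? (unmatched N) u | member? (unmatched N) v
        ... | yes u∈UN | _        = no-augmenting-edge N N-max u∈UN t∈UN u~t
        ... | no _     | yes v∈UN = separated-L N N-max t∈UN v∈UN (λ { refl → t∉U v∈U }) rest
        ... | no u∉UN  | no v∉UN with any? (member? ((unmatched N ∖ ⁅ t ⁆) ∖ unmatched M))
        ...   | no ∄z = <⇒≱ (fewer-unmatched M N t∈UN u∈U v∈U u≢v u∉UN v∉UN only-t) (M-max N)
          where
          only-t : unmatched N ∖ ⁅ t ⁆ ⊆ unmatched M
          only-t {z} z∈ = decidable-stable (member? (unmatched M) z) λ z∉UM → ∄z (z , z∈ , z∉UM)
        ...   | yes (z , (z∈UN , z≢t) , z∉UM) with partner M z in z↦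
        ...     | nothing = z∉UM (proj₁ z∈UN , refl)
        ...     | just z′ with partner N z′ in z′↦
        ...       | nothing =
          no-augmenting-edge N N-max z∈UN (partner-∈ M (partner-sym M z↦) , z′↦) (partner-adj M z↦)
        ...       | just _  = closer-refuted {exchanged} (exchanged-closer M z↦) (exchanged-maximum N-max)
                                             (exchanged-keeps-free t∈UN (z≢t ∘ sym))
          where open Exchange N z∈UN (partner-adj M z↦) z′↦

    unmatched-separated : ∀ L → Separated L
    unmatched-separated = <-rec Separated separate
      where
      separate : ∀ L → (∀ {L′} → L′ < L → Separated L′) → Separated L
      separate zero    _       M M-max u∈U v∈U u≢v [ _ ] = u≢v refl
      separate (suc L) shorter M M-max {u} {v} u∈U v∈U u≢v (step {y = t} _ u~t rest)
        with member? (unmatched M) t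
      ... | no t∉U = avoidable (walk-head rest) λ (N , N-max , t∈UN) →
        avoiding-t-refuted (shorter ≤-refl) M M-max u∈U v∈U u≢v u~t t∉U rest N N-max t∈UN
      ... | yes t∈U with t ≟ v
      ...   | yes refl = no-augmenting-edge M M-max u∈U t∈U u~t
      ...   | no t≢v   = shorter ≤-refl M M-max t∈U v∈U t≢v rest

  record Barrier (W : DecSet n) : Set₁ where
    field
      matching         : Matching W
      S R              : DecSet n
      S⊆W              : S ⊆ W
      R⊆W∖S            : R ⊆ W ∖ S
      R-separated      : ∀ {r r′ L} → r ∈ R → r′ ∈ R → r ≢ r′ → ¬ Walk (W ∖ S) r r′ L
      deficiency-bound : def matching + card S ≤ card R

  barrier-of-avoidable : (M : Matching W) → IsMaximum M →
                         (∀ {x} → x ∈ W → ¬ ¬ Avoidable W x) → Barrier W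
  barrier-of-avoidable M M-max avoidable = record
    { matching = M ; S = ∅ ; R = unmatched M ; S⊆W = λ () ; R⊆W∖S = λ (x∈W , _) → x∈W , λ ()
    ; R-separated = λ r∈R r′∈R r≢r′ →
        unmatched-separated _ M M-max r∈R r′∈R r≢r′ ∘ walk-mono proj₁
    ; deficiency-bound = ≤-reflexive (trans (cong (def M +_) (card-∅ {n})) (+-identityʳ (def M)))
    }
    where open Gallai avoidable

  covered-vertex-raises-def : ∀ {W x} → x ∈ W → (M : Matching W) → IsMaximum M →
                              ¬ Avoidable W x → (N : Matching (W ∖ ⁅ x ⁆)) → def M < def N
  covered-vertex-raises-def {W} {x} x∈W M M-max covered N =
    ≤∧≢⇒< (≤-pred (≤∧≢⇒< M≤N⁺ N⁺-not-maximum)) (def-parity x∈W M N)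
    where
    N⁺ : Matching W
    N⁺ = restore W x N
    M≤N⁺ : def M ≤ suc (def N)
    M≤N⁺ = subst (def M ≤_) (def-restore {W} x∈W N) (M-max N⁺)
    N⁺-not-maximum : def M ≢ suc (def N)
    N⁺-not-maximum same = covered (N⁺ , N⁺-maximum , x∈W , restore-free W x N)
      where
      N⁺-maximum : IsMaximum N⁺
      N⁺-maximum P = subst (_≤ def P) (trans same (sym (def-restore {W} x∈W N))) (M-max P)

  barrier-extend : ∀ {W x} → x ∈ W → (M : Matching W) → IsMaximum M → ¬ Avoidable W x →
                   Barrier (W ∖ ⁅ x ⁆) → Barrier W
  barrier-extend {W} {x} x∈W M M-max covered B = record
    { matching = M ; S = S ∪ ⁅ x ⁆ ; R = R
    ; S⊆W = λ { (inj₁ s∈S) → proj₁ (S⊆W s∈S) ; (inj₂ refl) → x∈W }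
    ; R⊆W∖S = λ r∈R → let ((r∈W , r≢x) , r∉S) = R⊆W∖S r∈R in r∈W , Sum.[ r∉S , r≢x ]
    ; R-separated = λ r∈R r′∈R r≢r′ → R-separated r∈R r′∈R r≢r′ ∘ walk-mono shrink
    ; deficiency-bound = bound
    }
    where
    open Barrier B
    shrink : W ∖ (S ∪ ⁅ x ⁆) ⊆ (W ∖ ⁅ x ⁆) ∖ S
    shrink (t∈W , t∉S∪x) = (t∈W , t∉S∪x ∘ inj₂) , t∉S∪x ∘ inj₁
    bound : def M + card (S ∪ ⁅ x ⁆) ≤ card R
    bound = begin
      def M + card (S ∪ ⁅ x ⁆)      ≡⟨ cong (def M +_) (card-∪-disjoint S ⁅ x ⁆ x∉S) ⟩
      def M + (card S + card ⁅ x ⁆) ≡⟨ cong (λ k → def M + (card S + k)) (card-⁅⁆ x) ⟩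
      def M + (card S + 1)          ≡⟨ cong (def M +_) (+-comm (card S) 1) ⟩
      def M + suc (card S)          ≡⟨ +-suc (def M) (card S) ⟩
      suc (def M) + card S          ≤⟨ +-monoˡ-≤ (card S) M<matching ⟩
      def matching + card S         ≤⟨ deficiency-bound ⟩
      card R                        ∎
      where
      open ≤-Reasoning
      x∉S : ∀ {s} → s ∈ S → s ≡ x → ⊥
      x∉S s∈S = proj₂ (S⊆W s∈S)
      M<matching : def M < def matching
      M<matching = covered-vertex-raises-def x∈W M M-max covered matching

  -- A vertex covered by every maximum matching goes into S; if there is none, Gallai's lemma
  -- gives S = ∅ and R = the unmatched vertices.
  barrier-exists : (W : DecSet n) → ¬ ¬ Barrier W
  barrier-exists = measure-rec card (λ W → ¬ ¬ Barrier W) build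
    where
    build : ∀ W → (∀ {W′} → card W′ < card W → ¬ ¬ Barrier W′) → ¬ ¬ Barrier W
    build W smaller-barrier =
      maximum-exists W >>= λ (M , M-max) →
      ¬¬-excluded-middle {A = Σ (Fin n) λ x → x ∈ W × ¬ Avoidable W x} >>= λ where
        (yes (x , x∈W , covered)) →
          smaller-barrier (≤-reflexive (sym (card-remove W x x∈W))) >>= λ B →
          pure (barrier-extend x∈W M M-max covered B)
        (no ∄covered) →
          pure (barrier-of-avoidable M M-max λ x∈W ¬avoidable → ∄covered (_ , x∈W , ¬avoidable))

  -- Triangle-free graphs

  Independent : DecSet n → Set
  Independent I = ∀ {a b} → a ∈ I → b ∈ I → ¬ Adj H a b

  record LowVertex (d : ℕ) : Set₁ where
    field
      vertex        : Fin n
      I             : DecSet n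
      vertex∈I      : vertex ∈ I
      I-independent : Independent I
      degree-bound  : d + card (neighbours H vertex) ≤ suc (card I)

  module TriangleFree (triangle-free : ∀ {a b c} → Adj H a b → Adj H b c → Adj H a c → ⊥)
    (S R : DecSet n) {r₀} (r₀∈R : r₀ ∈ R) (R⊆V∖S : R ⊆ full ∖ S)
    (R-separated : ∀ {r r′ L} → r ∈ R → r′ ∈ R → r ≢ r′ → ¬ Walk (full ∖ S) r r′ L)
    {d} (d+S≤R : d + card S ≤ card R) where

    R-independent : Independent R
    R-independent a∈R b∈R a~b =
      R-separated a∈R b∈R (Adj⇒≢ H a~b) (step (R⊆V∖S a∈R) a~b [ R⊆V∖S b∈R ])

    module _ (reach? : ∀ x → Dec (∃ λ L → Walk (full ∖ S) r₀ x L)) where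

      C : DecSet n
      C = record { member = λ x → ∃ λ L → Walk (full ∖ S) r₀ x L ; member? = reach? }

      C-neighbours : Fin n → DecSet n
      C-neighbours x = neighbours H x ∩ C

      r₀∈C : r₀ ∈ C
      r₀∈C = 0 , [ R⊆V∖S r₀∈R ]

      neighbours-in-C-or-S : ∀ {x} → x ∈ C → neighbours H x ⊆ C-neighbours x ∪ S
      neighbours-in-C-or-S (L , walk) {y} x~y with member? S y
      ... | yes y∈S = inj₂ y∈S
      ... | no  y∉S = inj₁ (x~y , suc L , walk-snoc walk x~y (tt , y∉S))

      C-avoids-R : ∀ {x r} → x ∈ C → r ∈ R → r ≢ r₀ → ¬ Adj H x r
      C-avoids-R (L , walk) r∈R r≢r₀ x~r =
        R-separated r₀∈R r∈R (r≢r₀ ∘ sym) (walk-snoc walk x~r (R⊆V∖S r∈R))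

      degree-in-C : ∀ {x} → x ∈ C → card (neighbours H x) ≤ card (C-neighbours x) + card S
      degree-in-C {x} x∈C = ≤-trans
        (card-mono (neighbours H x) (C-neighbours x ∪ S) (neighbours-in-C-or-S x∈C))
        (card-∪ (C-neighbours x) S)

      edgeless : (∀ {a b} → a ∈ C → b ∈ C → ¬ Adj H a b) → LowVertex d
      edgeless no-edge = record
        { vertex = r₀ ; I = R ; vertex∈I = r₀∈R ; I-independent = R-independent
        ; degree-bound = begin
            d + card (neighbours H r₀) ≤⟨ +-monoʳ-≤ d (card-mono (neighbours H r₀) S into-S) ⟩
            d + card S                 ≤⟨ d+S≤R ⟩
            card R                     ≤⟨ n≤1+n _ ⟩
            suc (card R)               ∎
        }
        where
        open ≤-Reasoning
        into-S : neighbours H r₀ ⊆ S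
        into-S r₀~y with neighbours-in-C-or-S r₀∈C r₀~y
        ... | inj₁ (_ , y∈C) = contradiction r₀~y (no-edge r₀∈C y∈C)
        ... | inj₂ y∈S       = y∈S

      with-edge : ∀ {a b} → a ∈ C → b ∈ C → Adj H a b →
                  card (C-neighbours a) ≤ card (C-neighbours b) → LowVertex d
      with-edge {a} {b} a∈C b∈C a~b fewer = record
        { vertex = a ; I = I ; vertex∈I = inj₁ (Adj-sym H a~b , a∈C) ; I-independent = independent
        ; degree-bound = begin
            d + card (neighbours H a)            ≤⟨ +-monoʳ-≤ d (degree-in-C a∈C) ⟩
            d + (card (C-neighbours a) + card S) ≡⟨ x∙yz≈y∙xz d (card (C-neighbours a)) (card S) ⟩
            card (C-neighbours a) + (d + card S) ≤⟨ +-mono-≤ fewer d+S≤R ⟩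
            card (C-neighbours b) + card R       ≡⟨ cong (card (C-neighbours b) +_) (card-remove R r₀ r₀∈R) ⟩
            card (C-neighbours b) + suc (card R₀) ≡⟨ +-suc _ _ ⟩
            suc (card (C-neighbours b) + card R₀) ≡⟨ cong suc (card-∪-disjoint (C-neighbours b) R₀ disjoint) ⟨
            suc (card I)                         ∎
        }
        where
        open ≤-Reasoning
        R₀ I : DecSet n
        R₀ = R ∖ ⁅ r₀ ⁆
        I = C-neighbours b ∪ R₀
        disjoint : ∀ {x} → x ∈ C-neighbours b → x ∈ R₀ → ⊥
        disjoint (_ , L , walk) (x∈R , x≢r₀) = R-separated r₀∈R x∈R (x≢r₀ ∘ sym) walk
        independent : Independent I
        independent (inj₁ (b~x , _))    (inj₁ (b~y , _))    x~y =
          triangle-free x~y (Adj-sym H b~y) (Adj-sym H b~x)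
        independent (inj₁ (_ , x∈C))    (inj₂ (y∈R , y≢r₀)) x~y = C-avoids-R x∈C y∈R y≢r₀ x~y
        independent (inj₂ (x∈R , x≢r₀)) (inj₁ (_ , y∈C))    x~y =
          C-avoids-R y∈C x∈R x≢r₀ (Adj-sym H x~y)
        independent (inj₂ (x∈R , _))    (inj₂ (y∈R , _))    x~y = R-independent x∈R y∈R x~y

      low-vertex-in-component : LowVertex d
      low-vertex-in-component
        with any? (λ a → any? λ b → member? C a ×-dec member? C b ×-dec T? (adj H a b))
      ... | no ∄edge = edgeless λ a∈C b∈C a~b → ∄edge (_ , _ , a∈C , b∈C , a~b)
      ... | yes (a , b , a∈C , b∈C , a~b)
        with ≤-total (card (C-neighbours a)) (card (C-neighbours b))
      ...   | inj₁ fewer = with-edge a∈C b∈C a~b fewer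
      ...   | inj₂ more  = with-edge b∈C a∈C (Adj-sym H a~b) more

    low-vertex : ¬ ¬ LowVertex d
    low-vertex = ¬¬-decidable _ >>= pure ∘ low-vertex-in-component

-- Colouring graphs of stability number at most two

nonadjacent? : (G : Graph n) (u v : Fin n) → Dec (¬ Adj G u v × u ≢ v)
nonadjacent? G u v = ¬? (T? (adj G u v)) ×-dec ¬? (u ≟ v)

-- ⌊_⌋ rather than does, so that toWitness and fromWitness apply to adjacency proofs.
complement : Graph n → Graph n
complement G = record
  { adj    = λ u v → ⌊ nonadjacent? G u v ⌋
  ; sym    = λ u v → begin
      ⌊ nonadjacent? G u v ⌋    ≡⟨ isYes≗does (nonadjacent? G u v) ⟩
      does (nonadjacent? G u v) ≡⟨ does-⇔ (mk⇔ swap swap) (nonadjacent? G u v) (nonadjacent? G v u) ⟩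
      does (nonadjacent? G v u) ≡⟨ isYes≗does (nonadjacent? G v u) ⟨
      ⌊ nonadjacent? G v u ⌋    ∎
  ; irrefl = λ v → trans (isYes≗does (nonadjacent? G v v))
                         (dec-false (nonadjacent? G v v) λ (_ , v≢v) → v≢v refl)
  }
  where
  open ≡-Reasoning
  swap : ∀ {u v} → ¬ Adj G u v × u ≢ v → ¬ Adj G v u × v ≢ u
  swap (u≁v , u≢v) = u≁v ∘ Adj-sym G , u≢v ∘ sym

complement-adj⁻ : ∀ (G : Graph n) {u v} → Adj (complement G) u v → ¬ Adj G u v
complement-adj⁻ G = proj₁ ∘ toWitness

complement-adj⁺ : ∀ (G : Graph n) {u v} → ¬ Adj G u v → u ≢ v → Adj (complement G) u v
complement-adj⁺ G u≁v u≢v = fromWitness (u≁v , u≢v)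

toSubset : DecSet n → Subset n
toSubset A = Vec.tabulate (does ∘ member? A)

card-toSubset : (A : DecSet n) → Subset.∣ toSubset A ∣ ≡ card A
card-toSubset {zero}  A = refl
card-toSubset {suc n} A with member? A zero
... | yes _ = cong suc (card-toSubset (preimage suc A))
... | no  _ = card-toSubset (preimage suc A)

∈-toSubset⁺ : (A : DecSet n) {x : Fin n} → x ∈ A → x Subset.∈ toSubset A
∈-toSubset⁺ A {x} x∈A =
  lookup⇒[]= x (toSubset A) (trans (lookup∘tabulate _ x) (dec-true (member? A x) x∈A))

∈-toSubset⁻ : (A : DecSet n) {x : Fin n} → x Subset.∈ toSubset A → x ∈ A
∈-toSubset⁻ A {x} x∈S = decidable-stable (member? A x) λ x∉A →
  case trans (trans (sym ([]=⇒lookup x∈S)) (lookup∘tabulate _ x)) (dec-false (member? A x) x∉A) of λ ()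

length-filter-tabulate : ∀ {m} (A : DecSet n) (f : Fin m → Fin n) →
                         length (filter (member? A) (List.tabulate f)) ≡ card (preimage f A)
length-filter-tabulate {m = zero}  A f = refl
length-filter-tabulate {m = suc m} A f with member? A (f zero)
... | yes _ = cong suc (length-filter-tabulate A (f ∘ suc))
... | no  _ = length-filter-tabulate A (f ∘ suc)

degree≡card-neighbours : (G : Graph n) (v : Fin n) → degree G v ≡ card (neighbours G v)
degree≡card-neighbours G v = trans (length-filter-tabulate (neighbours G v) id)
                                   (card-≐ (preimage id (neighbours G v)) (neighbours G v) (id , id))

degree-split : (G : Graph n) (v : Fin n) →
               card (neighbours G v) + suc (card (neighbours (complement G) v)) ≡ n
degree-split {n} G v = begin
  card NG + suc (card NH)            ≡⟨ cong (λ k → card NG + (k + card NH)) (card-⁅⁆ v) ⟨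
  card NG + (card ⁅ v ⁆ + card NH)   ≡⟨ cong (card NG +_) (card-∪-disjoint ⁅ v ⁆ NH v∉NH) ⟨
  card NG + card (⁅ v ⁆ ∪ NH)        ≡⟨ card-∪-disjoint NG (⁅ v ⁆ ∪ NH) G-and-not-G ⟨
  card (NG ∪ ⁅ v ⁆ ∪ NH)             ≡⟨ card-≐ (NG ∪ ⁅ v ⁆ ∪ NH) full ((λ _ → tt) , cover) ⟩
  card (full {n})                    ≡⟨ card-full ⟩
  n                                  ∎
  where
  open ≡-Reasoning
  NG NH : DecSet n
  NG = neighbours G v
  NH = neighbours (complement G) v
  v∉NH : ∀ {u} → u ≡ v → u ∈ NH → ⊥
  v∉NH refl v≁v = Adj⇒≢ (complement G) v≁v refl
  G-and-not-G : ∀ {u} → u ∈ NG → u ∈ ⁅ v ⁆ ∪ NH → ⊥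
  G-and-not-G v~u (inj₁ refl) = Adj⇒≢ G v~u refl
  G-and-not-G v~u (inj₂ v≁u)  = complement-adj⁻ G v≁u v~u
  cover : full ⊆ NG ∪ ⁅ v ⁆ ∪ NH
  cover {u} _ = classify (T? (adj G v u)) (u ≟ v)
    where
    classify : Dec (Adj G v u) → Dec (u ≡ v) → u ∈ NG ∪ ⁅ v ⁆ ∪ NH
    classify (yes v~u) _         = inj₁ v~u
    classify (no _)    (yes u≡v) = inj₂ (inj₁ u≡v)
    classify (no v≁u)  (no u≢v)  = inj₂ (inj₂ (complement-adj⁺ G v≁u (u≢v ∘ sym)))

complement-triangle-free : (G : Graph n) → StabilityAtMost G 2 → ∀ {a b c} →
  Adj (complement G) a b → Adj (complement G) b c → Adj (complement G) a c → ⊥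
complement-triangle-free {n} G α≤2 {a} {b} {c} a≁b b≁c a≁c =
  <⇒≱ (≤-reflexive (sym three)) (α≤2 (toSubset Δ) independent)
  where
  Δ : DecSet n
  Δ = ⁅ a ⁆ ∪ ⁅ b ⁆ ∪ ⁅ c ⁆
  distinct : ∀ {x y} → Adj (complement G) x y → x ≢ y
  distinct = Adj⇒≢ (complement G)
  three : Subset.∣ toSubset Δ ∣ ≡ 3
  three = begin
    Subset.∣ toSubset Δ ∣                   ≡⟨ card-toSubset Δ ⟩
    card Δ                                 ≡⟨ card-∪-disjoint ⁅ a ⁆ (⁅ b ⁆ ∪ ⁅ c ⁆) a∉bc ⟩
    card ⁅ a ⁆ + card (⁅ b ⁆ ∪ ⁅ c ⁆)      ≡⟨ cong (card ⁅ a ⁆ +_) (card-∪-disjoint ⁅ b ⁆ ⁅ c ⁆ b∉c) ⟩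
    card ⁅ a ⁆ + (card ⁅ b ⁆ + card ⁅ c ⁆) ≡⟨ cong₂ _+_ (card-⁅⁆ a) (cong₂ _+_ (card-⁅⁆ b) (card-⁅⁆ c)) ⟩
    3                                      ∎
    where
    open ≡-Reasoning
    a∉bc : ∀ {x} → x ≡ a → x ∈ ⁅ b ⁆ ∪ ⁅ c ⁆ → ⊥
    a∉bc refl (inj₁ refl) = distinct a≁b refl
    a∉bc refl (inj₂ refl) = distinct a≁c refl
    b∉c : ∀ {x} → x ≡ b → x ≡ c → ⊥
    b∉c refl refl = distinct b≁c refl
  co-adjacent : ∀ {x y} → x ∈ Δ → y ∈ Δ → x ≢ y → Adj (complement G) x y
  co-adjacent (inj₁ refl)        (inj₁ refl)        x≢y = contradiction refl x≢y
  co-adjacent (inj₁ refl)        (inj₂ (inj₁ refl)) _   = a≁b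
  co-adjacent (inj₁ refl)        (inj₂ (inj₂ refl)) _   = a≁c
  co-adjacent (inj₂ (inj₁ refl)) (inj₁ refl)        _   = Adj-sym (complement G) a≁b
  co-adjacent (inj₂ (inj₁ refl)) (inj₂ (inj₁ refl)) x≢y = contradiction refl x≢y
  co-adjacent (inj₂ (inj₁ refl)) (inj₂ (inj₂ refl)) _   = b≁c
  co-adjacent (inj₂ (inj₂ refl)) (inj₁ refl)        _   = Adj-sym (complement G) a≁c
  co-adjacent (inj₂ (inj₂ refl)) (inj₂ (inj₁ refl)) _   = Adj-sym (complement G) b≁c
  co-adjacent (inj₂ (inj₂ refl)) (inj₂ (inj₂ refl)) x≢y = contradiction refl x≢y
  independent : IsIndependent G (toSubset Δ)
  independent x y x∈Δ y∈Δ x~y =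
    complement-adj⁻ G (co-adjacent (∈-toSubset⁻ Δ x∈Δ) (∈-toSubset⁻ Δ y∈Δ) (Adj⇒≢ G x~y)) x~y

any-vector? : ∀ {k m} {P : Vec (Fin k) m → Set} → (∀ xs → Dec (P xs)) → Dec (∃ P)
any-vector? {m = zero}  P? = map′ ([] ,_) (λ { ([] , p) → p }) (P? [])
any-vector? {m = suc m} P? =
  map′ (λ (x , xs , p) → x ∷ xs , p) (λ { (x ∷ xs , p) → x , xs , p })
       (any? λ x → any-vector? λ xs → P? (x ∷ xs))

colorable? : (G : Graph n) (k : ℕ) → Dec (Colorable G k)
colorable? {n} G k =
  map′ (λ (c , proper) → Vec.lookup c , proper)
       (λ (c , proper) → Vec.tabulate c , tabulated proper)
       (any-vector? (proper? ∘ Vec.lookup))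
  where
  Proper : (Fin n → Fin k) → Set
  Proper c = ∀ u v → Adj G u v → c u ≢ c v
  proper? : ∀ c → Dec (Proper c)
  proper? c = all? λ u → all? λ v → T? (adj G u v) →-dec ¬? (c u ≟ c v)
  tabulated : ∀ {c} → Proper c → Proper (Vec.lookup (Vec.tabulate c))
  tabulated {c} proper u v u~v same =
    proper u v u~v (trans (sym (lookup∘tabulate c u)) (trans same (lookup∘tabulate c v)))

colorable-mono : (G : Graph n) {m k : ℕ} → m ≤ k → Colorable G m → Colorable G k
colorable-mono G m≤k (c , proper) = (λ x → inject≤ (c x) m≤k) ,
  λ u v u~v same → proper u v u~v (inject≤-injective m≤k m≤k _ _ same)

≤⌈/2⌉ : ∀ m x → 2 * m ≤ suc x → m ≤ ⌈ x /2⌉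
≤⌈/2⌉ m x 2m≤1+x = begin
  m              ≡⟨ n≡⌊n+n/2⌋ m ⟩
  ⌊ m + m /2⌋    ≡⟨ cong (λ k → ⌊ m + k /2⌋) (+-identityʳ m) ⟨
  ⌊ 2 * m /2⌋    ≤⟨ ⌊n/2⌋-mono 2m≤1+x ⟩
  ⌊ suc x /2⌋    ∎
  where open ≤-Reasoning

≤-maxOver : (f : Fin n → ℕ) (v : Fin n) → f v ≤ maxOver f
≤-maxOver {n} f v = ≤-foldr-⊔ (∈-map⁺ f (∈-allFin v))
  where
  ≤-foldr-⊔ : ∀ {x xs} → x List.∈ xs → x ≤ List.foldr _⊔_ 0 xs
  ≤-foldr-⊔ (here refl) = m≤m⊔n _ _
  ≤-foldr-⊔ (there x∈xs) = ≤-trans (≤-foldr-⊔ x∈xs) (m≤n⊔m _ _)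

module _ (G : Graph n) where

  open Matchings (complement G)

  colorable-by-classes : (M : Matching full) → Colorable G (PairClasses.classes (pair-classes M))
  colorable-by-classes M = (λ x → class x tt) , proper
    where
    open PairClasses (pair-classes M)
    proper : ∀ u v → Adj G u v → class u tt ≢ class v tt
    proper u v u~v same with class-injective tt tt same
    ... | inj₁ refl = Adj⇒≢ G u~v refl
    ... | inj₂ u↦v  = complement-adj⁻ G (partner-adj M u↦v) u~v

  clique-of-independent : (I : DecSet n) → Independent I → IsClique G (toSubset I)
  clique-of-independent I I-independent u v u∈I v∈I u≢v =
    decidable-stable (T? (adj G u v)) λ u≁v →
      I-independent (∈-toSubset⁻ I u∈I) (∈-toSubset⁻ I v∈I) (complement-adj⁺ G u≁v u≢v)

  low-vertex-of-barrier : StabilityAtMost G 2 → Fin n → (B : Barrier full) →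
                          ¬ ¬ LowVertex (def (Barrier.matching B))
  low-vertex-of-barrier α≤2 r B = case any? (member? R) of λ where
      (yes (r₀ , r₀∈R)) →
        TriangleFree.low-vertex triangle-free S R r₀∈R R⊆W∖S R-separated deficiency-bound
      (no ∄r) →
        TriangleFree.low-vertex triangle-free ∅ ⁅ r ⁆ refl (λ _ → tt , λ ())
          (λ { refl refl r≢r → contradiction refl r≢r }) (no-deficiency ∄r)
    where
    open Barrier B
    triangle-free : ∀ {a b c} → Adj (complement G) a b → Adj (complement G) b c →
                    Adj (complement G) a c → ⊥
    triangle-free = complement-triangle-free G α≤2
    no-deficiency : ¬ ∃ (_∈ R) → def matching + card (∅ {n}) ≤ card ⁅ r ⁆
    no-deficiency ∄r = begin
      def matching + card (∅ {n}) ≡⟨ cong (def matching +_) (card-∅ {n}) ⟩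
      def matching + 0            ≤⟨ +-monoʳ-≤ (def matching) z≤n ⟩
      def matching + card S       ≤⟨ deficiency-bound ⟩
      card R                      ≡⟨ card-empty R (λ x x∈R → ∄r (x , x∈R)) ⟩
      0                           ≤⟨ z≤n ⟩
      card ⁅ r ⁆                  ∎
      where open ≤-Reasoning

  colorable-by-low-vertex : (ω : Fin n → ℕ) → (∀ v → IsLocalCliqueNumber G v (ω v)) →
                            (M : Matching full) → LowVertex (def M) → Colorable G (gammaL G ω)
  colorable-by-low-vertex ω ω-spec M L = colorable-mono G classes≤γ (colorable-by-classes M)
    where
    open LowVertex L
    open PairClasses (pair-classes M) using (classes; classes-twice)
    dG dH : ℕ
    dG = card (neighbours G vertex)
    dH = card (neighbours (complement G) vertex)
    I≤ω : card I ≤ ω vertex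
    I≤ω = subst (_≤ ω vertex) (card-toSubset I)
      (proj₂ (ω-spec vertex) (toSubset I) (clique-of-independent I I-independent)
             (∈-toSubset⁺ I vertex∈I))
    regroup₁ : ∀ a b c → a + suc b + c ≡ a + suc (c + b)
    regroup₁ = solve-∀
    regroup₂ : ∀ a w → a + suc (suc w) ≡ suc (a + 1 + w)
    regroup₂ = solve-∀
    twice-classes-bound : 2 * classes ≤ suc (degree G vertex + 1 + ω vertex)
    twice-classes-bound = begin
      2 * classes                          ≡⟨ classes-twice ⟩
      card (full {n}) + def M              ≡⟨ cong (_+ def M) (trans card-full (sym (degree-split G _))) ⟩
      dG + suc dH + def M                  ≡⟨ regroup₁ dG dH (def M) ⟩
      dG + suc (def M + dH)                ≤⟨ +-monoʳ-≤ dG (s≤s (≤-trans degree-bound (s≤s I≤ω))) ⟩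
      dG + suc (suc (ω vertex))            ≡⟨ regroup₂ dG (ω vertex) ⟩
      suc (dG + 1 + ω vertex)              ≡⟨ cong (λ d → suc (d + 1 + ω vertex)) (degree≡card-neighbours G _) ⟨
      suc (degree G vertex + 1 + ω vertex) ∎
      where open ≤-Reasoning
    classes≤γ : classes ≤ gammaL G ω
    classes≤γ = ≤-trans (≤⌈/2⌉ classes _ twice-classes-bound)
                        (≤-maxOver (λ v → ⌈ (degree G v + 1 + ω v) /2⌉) vertex)

theorem2p4 : (n : ℕ) (G : Graph n) → StabilityAtMost G 2 →
    (ω : Fin n → ℕ) → (∀ v → IsLocalCliqueNumber G v (ω v)) →
    Colorable G (gammaL G ω)
theorem2p4 zero    G α≤2 ω ω-spec = (λ ()) , λ ()
theorem2p4 (suc n) G α≤2 ω ω-spec = decidable-stable (colorable? G (gammaL G ω)) do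
  B ← barrier-exists full
  L ← low-vertex-of-barrier G α≤2 zero B
  pure (colorable-by-low-vertex G ω ω-spec (Barrier.matching B) L)
  where open Matchings (complement G)
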